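{- For any groves $x$ and $y$ of planar trees one has $\sigma(x\times y)=\sigma(x)\times\sigma(y)$.
   Context: A planar tree of degree $n\ge0$ is a planar rooted tree (up to planar isotopy) with $n+1$ leaves in which every internal vertex has at least two inputs; $T_n$ is the set of these trees, $T_0=\{|\}$, $T_1=\{1\}$. For trees $x^{(0)},\dots,x^{(k)}$ ($k\ge1$), the grafting $x^{(0)}\vee\cdots\vee x^{(k)}$ joins their roots (in this order) to a new vertex carrying a new root; every tree $x$ of positive degree decomposes uniquely as $x=x^{(0)}\vee\cdots\vee x^{(k)}$, $k\ge1$. Grafting involving groves is elementwise; a grove is a nonempty subset of some $T_n$, and operations on groves are extended from trees by distributivity (union over pairs). For $x=x^{(0)}\vee\cdots\vee x^{(k)}$, $y=y^{(0)}\vee\cdots\vee y^{(\ell)}$ of positive degree: $x\dashv y:=x^{(0)}\vee\cdots\vee x^{(k-1)}\vee(x^{(k)}+y)$, $x\perp y:=x^{(0)}\vee\cdots\vee x^{(k-1)}\vee(x^{(k)}+y^{(0)})\vee y^{(1)}\vee\cdots\vee y^{(\ell)}$, $x\vdash y:=(x+y^{(0)})\vee y^{(1)}\vee\cdots\vee y^{(\ell)}$, $x+y:=(x\dashv y)\cup(x\perp y)\cup(x\vdash y)$ (recursively), with $|+x=x+|=x$; for $x\ne|$: $x\dashv|=x$, $|\dashv x=|$, $x\vdash|=|$, $|\vdash x=x$, $x\perp|=|\perp x=|$; by convention $|\dashv|=|\vdash|=|\perp|=|$. Product: for a tree $x$ and a grove $y$, $W_|(y):=|$, and for $x=x^{(0)}\vee\cdots\vee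 x^{(k)}$, $W_x(y):=W_{x^{(0)}}(y)\vdash\big(M\dashv W_{x^{(k)}}(y)\big)$, where $M$ is the left-associated iterated Middle sum of the sequence $y,\,W_{x^{(1)}}(y),\,y,\,W_{x^{(2)}}(y),\dots,W_{x^{(k-1)}}(y),\,y$ ($k$ copies of $y$) in which each term $W_{x^{(i)}}(y)$ with $x^{(i)}=|$ is omitted. Then $x\times y:=W_x(y)$, and for a grove $X$, $X\times y:=\bigcup_{x\in X}x\times y$. The involution $\sigma$ maps a tree to its mirror image with respect to the vertical axis through the root, acting elementwise on groves. -}

module Defs where

open import Data.Nat using (ℕ; zero; suc) renaming (_+_ to _+ℕ_)
open import Data.List using (List; []; _∷_; [_]; _++_; map; concatMap)
open import Data.List.Relation.Unary.All using (All)
open import Data.List.Membership.Propositional using (_∈_)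
open import Data.Product using (∃) renaming (_×_ to _×ₚ_)
open import Relation.Binary.PropositionalEquality using (_≡_)
open import Function.Bundles using (_⇔_)

-- Planar rooted trees in which every internal vertex has at least two inputs.
--   leaf        is the tree |  (degree 0, one leaf)
--   node a ts   is the grafting  a ∨ t₁ ∨ ⋯ ∨ tₖ  where ts = t₁,…,tₖ (k ≥ 1)
-- so the children of an internal vertex form a list of length ≥ 2 by construction.
mutual
  data Tree : Set where
    leaf : Tree
    node : Tree → Trees → Tree

  data Trees : Set where
    one  : Tree → Trees
    cons : Tree → Trees → Trees

-- degree = (number of leaves) - 1
mutual
  degree : Tree → ℕ
  degree leaf       = 0
  degree (node a ts) = degree a +ℕ degreesT ts

  degreesT : Trees → ℕ
  degreesT (one t)     = suc (degree t)
  degreesT (cons t ts) = suc (degree t +ℕ degreesT ts)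

-- Groves are represented by finite lists of trees, read as the set of their
-- elements (duplicates and order are irrelevant; equality of groves is
-- extensional equality of membership, see _≋_).
Grove : Set
Grove = List Tree

IsGrove : Grove → Set
IsGrove X = (X ≡ [] → Data.Empty.⊥) ×ₚ ∃ λ n → All (λ t → degree t ≡ n) X
  where import Data.Empty

_≋_ : Grove → Grove → Set
X ≋ Y = ∀ t → (t ∈ X) ⇔ (t ∈ Y)

mutual
  _+ᵗ_ : Tree → Tree → List Tree
  leaf +ᵗ y = [ y ]
  node a ts +ᵗ leaf = [ node a ts ]
  node a ts +ᵗ node p qs =
    (node a ts ⊣ᵗ node p qs) ++ ((node a ts ⊥ᵗ node p qs) ++ (node a ts ⊢ᵗ node p qs))

  _⊣ᵗ_ : Tree → Tree → List Tree
  leaf ⊣ᵗ y = [ leaf ]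
  node a ts ⊣ᵗ leaf = [ node a ts ]
  node a ts ⊣ᵗ node p qs = map (node a) (lastPlus ts (node p qs))

  _⊥ᵗ_ : Tree → Tree → List Tree
  leaf ⊥ᵗ y = [ leaf ]
  node a ts ⊥ᵗ leaf = [ leaf ]
  node a ts ⊥ᵗ node p qs = map (node a) (lastPlusApp ts p qs)

  _⊢ᵗ_ : Tree → Tree → List Tree
  x ⊢ᵗ leaf = [ leaf ]
  leaf ⊢ᵗ node p qs = [ node p qs ]
  node a ts ⊢ᵗ node p qs = map (λ z → node z qs) (node a ts +ᵗ p)

  lastPlus : Trees → Tree → List Trees
  lastPlus (one t) y = map one (t +ᵗ y)
  lastPlus (cons t ts) y = map (cons t) (lastPlus ts y)

  lastPlusApp : Trees → Tree → Trees → List Trees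
  lastPlusApp (one t) p qs = map (λ z → cons z qs) (t +ᵗ p)
  lastPlusApp (cons t ts) p qs = map (cons t) (lastPlusApp ts p qs)

lift : (Tree → Tree → List Tree) → Grove → Grove → Grove
lift f X Y = concatMap (λ x → concatMap (λ y → f x y) Y) X

_⊣_ _⊥_ _⊢_ _+_ : Grove → Grove → Grove
_⊣_ = lift _⊣ᵗ_
_⊥_ = lift _⊥ᵗ_
_⊢_ = lift _⊢ᵗ_
_+_ = lift _+ᵗ_

infixl 6 _⊣_ _⊥_ _⊢_

-- For x = x⁽⁰⁾ ∨ x⁽¹⁾ ∨ ⋯ ∨ x⁽ᵏ⁾ :
--   W_x(y) = W_{x⁽⁰⁾}(y) ⊢ (M ⊣ W_{x⁽ᵏ⁾}(y)),
--   M = y ⊥ W_{x⁽¹⁾}(y) ⊥ y ⊥ ⋯ ⊥ W_{x⁽ᵏ⁻¹⁾}(y) ⊥ y   (left associated,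
--       terms W_{x⁽ⁱ⁾}(y) with x⁽ⁱ⁾ = | omitted).
-- WM ts y M processes x⁽¹⁾,…,x⁽ᵏ⁾ with accumulator M (initially y).
mutual
  W : Tree → Grove → Grove
  W leaf y = [ leaf ]
  W (node a ts) y = W a y ⊢ WM ts y y

  WM : Trees → Grove → Grove → Grove
  WM (one t) y M = M ⊣ W t y
  WM (cons leaf ts) y M = WM ts y (M ⊥ y)
  WM (cons (node b us) ts) y M = WM ts y ((M ⊥ W (node b us) y) ⊥ y)

_×ᵗ_ : Tree → Grove → Grove
x ×ᵗ y = W x y

_×_ : Grove → Grove → Grove
X × Y = concatMap (λ x → x ×ᵗ Y) X

mutual
  σᵗ : Tree → Tree
  σᵗ leaf = leaf
  σᵗ (node a ts) = revNode ts (one (σᵗ a))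

  revNode : Trees → Trees → Tree
  revNode (one t) acc = node (σᵗ t) acc
  revNode (cons t ts) acc = revNode ts (cons (σᵗ t) acc)

σ : Grove → Grove
σ = map σᵗ

-- σ is an anti-automorphism of the three sums: by induction along the recursion defining +,
-- σ(x ⊣ y) = σy ⊢ σx, σ(x ⊥ y) = σy ⊥ σx and σ(x ⊢ y) = σy ⊣ σx, hence σ(x + y) = σy + σx.
-- Moreover ⊥ is associative and (x ⊢ y) ⊣ z = x ⊢ (y ⊣ z).  Mirroring
-- W_x(y) = W_{x⁽⁰⁾}(y) ⊢ (M ⊣ W_{x⁽ᵏ⁾}(y)) therefore gives σW_{x⁽ᵏ⁾}(y) ⊢ (σM ⊣ σW_{x⁽⁰⁾}(y)),
-- and σM is the alternating ⊥-product of σy and the σW_{x⁽ⁱ⁾}(y) in reversed order, which is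
-- exactly the Middle sum occurring in W_{σx}(σy).  Induction on x gives σW_x(y) = W_{σx}(σy).
module Submission where

open import Defs
open import Data.List using (List; []; [_]; _++_; map; concatMap)
open import Data.List.Properties
  using (map-∘; map-cong; map-++; ++-identityʳ; concatMap-map; concatMap-cong; concatMap-pure; map-concatMap)
open import Data.List.Membership.Propositional using (_∈_; find; lose)
open import Data.List.Membership.Propositional.Properties using (∈-map⁺; ∈-++⁺ˡ; ∈-concatMap⁺; ∈-concatMap⁻)
open import Data.List.Relation.Unary.Any using (here)
import Data.List.Relation.Binary.BagAndSetEquality as BagSet
open import Data.List.Relation.Binary.Permutation.Propositional using (_↭_; ↭-sym; ↭-trans; ↭-reflexive)
open import Data.List.Relation.Binary.Permutation.Propositional.Properties using (∈-resp-↭; ++-comm; ++⁺ʳ)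
import Data.List.Properties as List
open import Data.Product using (∃; ∃₂; _,_) renaming (_×_ to _×ₚ_)
open import Relation.Binary.Bundles using (Setoid)
open import Relation.Binary.Structures using (IsEquivalence)
open import Relation.Nullary using (contradiction)
open import Relation.Binary.PropositionalEquality using (_≡_; _≢_; refl; sym; trans; cong; cong₂)
open import Function.Bundles using (mk⇔; Equivalence)
import Function.Properties.Equivalence as ⇔

≋-isEquivalence : IsEquivalence _≋_
≋-isEquivalence = record
  { refl  = λ _ → ⇔.refl
  ; sym   = λ e t → ⇔.sym (e t)
  ; trans = λ e f t → ⇔.trans (e t) (f t)
  }

≋-setoid : Setoid _ _
≋-setoid = record { isEquivalence = ≋-isEquivalence }

open Setoid ≋-setoid using () renaming (refl to ≋-refl; sym to ≋-sym; reflexive to ≡⇒≋)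
open import Relation.Binary.Reasoning.Setoid ≋-setoid

⊆⇒≋ : ∀ {X Y} → (∀ {t} → t ∈ X → t ∈ Y) → (∀ {t} → t ∈ Y → t ∈ X) → X ≋ Y
⊆⇒≋ f g t = mk⇔ f g

↭⇒≋ : ∀ {X Y} → X ↭ Y → X ≋ Y
↭⇒≋ p = ⊆⇒≋ (λ t∈ → ∈-resp-↭ p t∈) (λ t∈ → ∈-resp-↭ (↭-sym p) t∈)

map-≋ : ∀ (f : Tree → Tree) {X Y} → X ≋ Y → map f X ≋ map f Y
map-≋ f e t = BagSet.map-cong (λ _ → refl) (λ {u} → e u) {t}

++-≋ : ∀ {A A' B B'} → A ≋ A' → B ≋ B' → (A ++ B) ≋ (A' ++ B')
++-≋ e f t = BagSet.++-cong (λ {u} → e u) (λ {u} → f u) {t}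

concatMap-≋ : ∀ {X X' : Grove} {f g : Tree → Grove} → X ≋ X' → (∀ x → f x ≋ g x) →
              concatMap f X ≋ concatMap g X'
concatMap-≋ e f≋g t = BagSet.>>=-cong (λ {u} → e u) (λ x {u} → f≋g x u) {t}

++-swap-outer : ∀ A B C → (A ++ (B ++ C)) ≋ (C ++ (B ++ A))
++-swap-outer A B C = ↭⇒≋ (↭-trans (++-comm A (B ++ C))
                          (↭-trans (++⁺ʳ A (++-comm B C)) (↭-reflexive (List.++-assoc C B A))))

module _ {A B : Set} {h : A → B → Grove} {X : List A} {Y : List B} where

  ∈-concatMap₂⁺ : ∀ {x y t} → x ∈ X → y ∈ Y → t ∈ h x y → t ∈ concatMap (λ x → concatMap (h x) Y) X
  ∈-concatMap₂⁺ x∈ y∈ t∈ = ∈-concatMap⁺ _ (lose x∈ (∈-concatMap⁺ _ (lose y∈ t∈)))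

  ∈-concatMap₂⁻ : ∀ {t} → t ∈ concatMap (λ x → concatMap (h x) Y) X →
                  ∃₂ λ x y → x ∈ X ×ₚ y ∈ Y ×ₚ t ∈ h x y
  ∈-concatMap₂⁻ t∈ with find (∈-concatMap⁻ _ {xs = X} t∈)
  ... | x , x∈ , t∈′ with find (∈-concatMap⁻ (h x) {xs = Y} t∈′)
  ... | y , y∈ , t∈″ = x , y , x∈ , y∈ , t∈″

concatMap-comm-⊆ : ∀ {A B : Set} (h : A → B → Grove) X Y {t} → t ∈ concatMap (λ x → concatMap (h x) Y) X →
                   t ∈ concatMap (λ y → concatMap (λ x → h x y) X) Y
concatMap-comm-⊆ h X Y t∈ = let x , y , x∈ , y∈ , t∈′ = ∈-concatMap₂⁻ {h = h} {X} {Y} t∈ in ∈-concatMap₂⁺ y∈ x∈ t∈′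

concatMap-comm : ∀ {A B : Set} (h : A → B → Grove) X Y →
                 concatMap (λ x → concatMap (h x) Y) X ≋ concatMap (λ y → concatMap (λ x → h x y) X) Y
concatMap-comm h X Y = ⊆⇒≋ (concatMap-comm-⊆ h X Y) (concatMap-comm-⊆ (λ y x → h x y) Y X)

map-as-concatMap : ∀ {A : Set} (f : A → Tree) xs → map f xs ≡ concatMap (λ x → [ f x ]) xs
map-as-concatMap f xs = trans (sym (concatMap-pure (map f xs))) (concatMap-map [_] f xs)

concatMap-map-comm : ∀ {A B : Set} (F : A → B → Tree) Z Q →
                     concatMap (λ z → map (F z) Q) Z ≋ concatMap (λ q → map (λ z → F z q) Z) Q
concatMap-map-comm F Z Q = begin
  concatMap (λ z → map (F z) Q) Z
    ≡⟨ concatMap-cong (λ z → map-as-concatMap (F z) Q) Z ⟩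
  concatMap (λ z → concatMap (λ q → [ F z q ]) Q) Z
    ≈⟨ concatMap-comm (λ z q → [ F z q ]) Z Q ⟩
  concatMap (λ q → concatMap (λ z → [ F z q ]) Z) Q
    ≡⟨ concatMap-cong (λ q → map-as-concatMap (λ z → F z q) Z) Q ⟨
  concatMap (λ q → map (λ z → F z q) Z) Q ∎

lift-cong : ∀ f {X X' Y Y'} → X ≋ X' → Y ≋ Y' → lift f X Y ≋ lift f X' Y'
lift-cong f eX eY = concatMap-≋ eX (λ x → concatMap-≋ eY (λ y → ≋-refl))

σ-Reverses : (Tree → Tree → List Tree) → (Tree → Tree → List Tree) → Tree → Tree → Set
σ-Reverses f g x y = σ (f x y) ≋ g (σᵗ y) (σᵗ x)

lift-σ : ∀ f g → (∀ x y → σ-Reverses f g x y) → ∀ X Y → σ (lift f X Y) ≋ lift g (σ Y) (σ X)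
lift-σ f g σfg X Y = begin
  map σᵗ (concatMap (λ x → concatMap (f x) Y) X)
    ≡⟨ map-concatMap σᵗ _ X ⟩
  concatMap (λ x → map σᵗ (concatMap (f x) Y)) X
    ≡⟨ concatMap-cong (λ x → map-concatMap σᵗ (f x) Y) X ⟩
  concatMap (λ x → concatMap (λ y → σ (f x y)) Y) X
    ≈⟨ concatMap-≋ {X} ≋-refl (λ x → concatMap-≋ {Y} ≋-refl (σfg x)) ⟩
  concatMap (λ x → concatMap (λ y → g (σᵗ y) (σᵗ x)) Y) X
    ≈⟨ concatMap-comm (λ x y → g (σᵗ y) (σᵗ x)) X Y ⟩
  concatMap (λ y → concatMap (λ x → g (σᵗ y) (σᵗ x)) X) Y
    ≡⟨ concatMap-cong (λ y → concatMap-map (g (σᵗ y)) σᵗ X) Y ⟨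
  concatMap (λ y → concatMap (g (σᵗ y)) (σ X)) Y
    ≡⟨ concatMap-map _ σᵗ Y ⟨
  lift g (σ Y) (σ X) ∎

lift-assoc : ∀ f g → (∀ a b c → concatMap (λ u → f u c) (g a b) ≋ concatMap (g a) (f b c)) →
             ∀ A B C → lift f (lift g A B) C ≋ lift g A (lift f B C)
lift-assoc f g assoc A B C = ⊆⇒≋ to from
  where
    to : ∀ {t} → t ∈ lift f (lift g A B) C → t ∈ lift g A (lift f B C)
    to t∈ with ∈-concatMap₂⁻ {h = f} {lift g A B} {C} t∈
    ... | u , c , u∈ , c∈ , t∈fuc with ∈-concatMap₂⁻ {h = g} {A} {B} u∈
    ... | a , b , a∈ , b∈ , u∈gab
      with find (∈-concatMap⁻ (g a) (Equivalence.to (assoc a b c _) (∈-concatMap⁺ _ (lose u∈gab t∈fuc))))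
    ... | v , v∈ , t∈gav = ∈-concatMap₂⁺ a∈ (∈-concatMap₂⁺ b∈ c∈ v∈) t∈gav
    from : ∀ {t} → t ∈ lift g A (lift f B C) → t ∈ lift f (lift g A B) C
    from t∈ with ∈-concatMap₂⁻ {h = g} {A} {lift f B C} t∈
    ... | a , v , a∈ , v∈ , t∈gav with ∈-concatMap₂⁻ {h = f} {B} {C} v∈
    ... | b , c , b∈ , c∈ , v∈fbc
      with find (∈-concatMap⁻ (λ u → f u c) (Equivalence.from (assoc a b c _) (∈-concatMap⁺ _ (lose v∈fbc t∈gav))))
    ... | u , u∈ , t∈fuc = ∈-concatMap₂⁺ (∈-concatMap₂⁺ a∈ b∈ u∈) c∈ t∈fuc

last : Trees → Tree
last (one t)     = t
last (cons _ ts) = last ts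

setLast : Trees → Tree → Trees
setLast (one _)     z = one z
setLast (cons t ts) z = cons t (setLast ts z)

spliceLast : Trees → Tree → Trees → Trees
spliceLast (one _)     z qs = cons z qs
spliceLast (cons t ts) z qs = cons t (spliceLast ts z qs)

revσInit : Trees → Trees → Trees
revσInit (one _)     acc = acc
revσInit (cons t ts) acc = revσInit ts (cons (σᵗ t) acc)

revNode-last : ∀ ts acc → revNode ts acc ≡ node (σᵗ (last ts)) (revσInit ts acc)
revNode-last (one t)     acc = refl
revNode-last (cons t ts) acc = revNode-last ts (cons (σᵗ t) acc)

σᵗ-node : ∀ a ts → σᵗ (node a ts) ≡ node (σᵗ (last ts)) (revσInit ts (one (σᵗ a)))
σᵗ-node a ts = revNode-last ts (one (σᵗ a))

σᵗ-node≢leaf : ∀ a ts → σᵗ (node a ts) ≢ leaf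
σᵗ-node≢leaf a ts eq with trans (sym (σᵗ-node a ts)) eq
... | ()

last-setLast : ∀ ts z → last (setLast ts z) ≡ z
last-setLast (one _)     z = refl
last-setLast (cons _ ts) z = last-setLast ts z

revσInit-setLast : ∀ ts z acc → revσInit (setLast ts z) acc ≡ revσInit ts acc
revσInit-setLast (one _)     z acc = refl
revσInit-setLast (cons t ts) z acc = revσInit-setLast ts z (cons (σᵗ t) acc)

last-spliceLast : ∀ ts z qs → last (spliceLast ts z qs) ≡ last qs
last-spliceLast (one _)     z qs = refl
last-spliceLast (cons _ ts) z qs = last-spliceLast ts z qs

revσInit-spliceLast : ∀ ts z qs acc →
                      revσInit (spliceLast ts z qs) acc ≡ revσInit qs (cons (σᵗ z) (revσInit ts acc))
revσInit-spliceLast (one _)     z qs acc = refl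
revσInit-spliceLast (cons t ts) z qs acc = revσInit-spliceLast ts z qs (cons (σᵗ t) acc)

last-revσInit : ∀ qs acc → last (revσInit qs acc) ≡ last acc
last-revσInit (one _)     acc = refl
last-revσInit (cons t qs) acc = last-revσInit qs (cons (σᵗ t) acc)

setLast-revσInit : ∀ qs acc w → setLast (revσInit qs acc) w ≡ revσInit qs (setLast acc w)
setLast-revσInit (one _)     acc w = refl
setLast-revσInit (cons t qs) acc w = setLast-revσInit qs (cons (σᵗ t) acc) w

spliceLast-revσInit : ∀ qs acc w rs → spliceLast (revσInit qs acc) w rs ≡ revσInit qs (spliceLast acc w rs)
spliceLast-revσInit (one _)     acc w rs = refl
spliceLast-revσInit (cons t qs) acc w rs = spliceLast-revσInit qs (cons (σᵗ t) acc) w rs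

spliceLast-assoc : ∀ as z bs w cs → spliceLast (spliceLast as z bs) w cs ≡ spliceLast as z (spliceLast bs w cs)
spliceLast-assoc (one _)     z bs w cs = refl
spliceLast-assoc (cons t as) z bs w cs = cong (cons t) (spliceLast-assoc as z bs w cs)

lastPlus-setLast : ∀ ts y → lastPlus ts y ≡ map (setLast ts) (last ts +ᵗ y)
lastPlus-setLast (one _)     y = refl
lastPlus-setLast (cons t ts) y = trans (cong (map (cons t)) (lastPlus-setLast ts y)) (sym (map-∘ (last ts +ᵗ y)))

lastPlusApp-spliceLast : ∀ ts p qs → lastPlusApp ts p qs ≡ map (λ z → spliceLast ts z qs) (last ts +ᵗ p)
lastPlusApp-spliceLast (one _)     p qs = refl
lastPlusApp-spliceLast (cons t ts) p qs =
  trans (cong (map (cons t)) (lastPlusApp-spliceLast ts p qs)) (sym (map-∘ (last ts +ᵗ p)))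

leaf-⊢ᵗ : ∀ t → leaf ⊢ᵗ t ≡ [ t ]
leaf-⊢ᵗ leaf       = refl
leaf-⊢ᵗ (node _ _) = refl

⊣ᵗ-leaf : ∀ t → t ⊣ᵗ leaf ≡ [ t ]
⊣ᵗ-leaf leaf       = refl
⊣ᵗ-leaf (node _ _) = refl

⊥ᵗ-leaf : ∀ t → t ⊥ᵗ leaf ≡ [ leaf ]
⊥ᵗ-leaf leaf       = refl
⊥ᵗ-leaf (node _ _) = refl

+ᵗ-leaf : ∀ t → t +ᵗ leaf ≡ [ t ]
+ᵗ-leaf leaf       = refl
+ᵗ-leaf (node _ _) = refl

+ᵗ-unfold : ∀ u v → u ≢ leaf → v ≢ leaf → u +ᵗ v ≡ (u ⊣ᵗ v) ++ ((u ⊥ᵗ v) ++ (u ⊢ᵗ v))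
+ᵗ-unfold leaf       v          u≢leaf _      = contradiction refl u≢leaf
+ᵗ-unfold (node _ _) leaf       _      v≢leaf = contradiction refl v≢leaf
+ᵗ-unfold (node _ _) (node _ _) _      _      = refl

⊣ᵗ-node : ∀ a ts v → v ≢ leaf → node a ts ⊣ᵗ v ≡ map (λ z → node a (setLast ts z)) (last ts +ᵗ v)
⊣ᵗ-node a ts leaf        v≢leaf = contradiction refl v≢leaf
⊣ᵗ-node a ts (node p qs) _      = trans (cong (map (node a)) (lastPlus-setLast ts (node p qs))) (sym (map-∘ _))

⊥ᵗ-node : ∀ a ts p qs → node a ts ⊥ᵗ node p qs ≡ map (λ z → node a (spliceLast ts z qs)) (last ts +ᵗ p)
⊥ᵗ-node a ts p qs = trans (cong (map (node a)) (lastPlusApp-spliceLast ts p qs)) (sym (map-∘ _))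

⊢ᵗ-node : ∀ u b rs → u ≢ leaf → u ⊢ᵗ node b rs ≡ map (λ z → node z rs) (u +ᵗ b)
⊢ᵗ-node leaf       b rs u≢leaf = contradiction refl u≢leaf
⊢ᵗ-node (node _ _) b rs _      = refl

map-fuse : ∀ {A B C : Set} {f : B → C} {g : A → B} {k : A → C} →
           (∀ z → f (g z) ≡ k z) → ∀ xs → map f (map g xs) ≡ map k xs
map-fuse fg≗k xs = trans (sym (map-∘ xs)) (map-cong fg≗k xs)

σ-map : ∀ {G F : Tree → Tree} → (∀ z → σᵗ (G z) ≡ F (σᵗ z)) → ∀ Z → σ (map G Z) ≡ map F (σ Z)
σ-map σG≗Fσ Z = trans (map-fuse σG≗Fσ Z) (map-∘ Z)

-- The recursion follows that of _+ᵗ_: every cycle shrinks the left tree, or keeps it and shrinks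
-- the right one; σ-+ᵗ-last turns the call on the last child into a structural one.
mutual
  σ-+ᵗ : ∀ x y → σ-Reverses _+ᵗ_ _+ᵗ_ x y
  σ-+ᵗ leaf        y           = ≡⇒≋ (sym (+ᵗ-leaf (σᵗ y)))
  σ-+ᵗ (node a ts) leaf        = ≋-refl
  σ-+ᵗ x@(node a ts) y@(node p qs) = begin
    σ ((x ⊣ᵗ y) ++ ((x ⊥ᵗ y) ++ (x ⊢ᵗ y)))
      ≡⟨ trans (map-++ σᵗ (x ⊣ᵗ y) _) (cong (σ (x ⊣ᵗ y) ++_) (map-++ σᵗ (x ⊥ᵗ y) _)) ⟩
    σ (x ⊣ᵗ y) ++ (σ (x ⊥ᵗ y) ++ σ (x ⊢ᵗ y))
      ≈⟨ ++-≋ (σ-⊣ᵗ x y) (++-≋ (σ-⊥ᵗ x y) (σ-⊢ᵗ x y)) ⟩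
    (σᵗ y ⊢ᵗ σᵗ x) ++ ((σᵗ y ⊥ᵗ σᵗ x) ++ (σᵗ y ⊣ᵗ σᵗ x))
      ≈⟨ ++-swap-outer (σᵗ y ⊢ᵗ σᵗ x) (σᵗ y ⊥ᵗ σᵗ x) (σᵗ y ⊣ᵗ σᵗ x) ⟩
    (σᵗ y ⊣ᵗ σᵗ x) ++ ((σᵗ y ⊥ᵗ σᵗ x) ++ (σᵗ y ⊢ᵗ σᵗ x))
      ≡⟨ +ᵗ-unfold (σᵗ y) (σᵗ x) (σᵗ-node≢leaf p qs) (σᵗ-node≢leaf a ts) ⟨
    σᵗ y +ᵗ σᵗ x ∎

  σ-+ᵗ-last : ∀ ts y → σ-Reverses _+ᵗ_ _+ᵗ_ (last ts) y
  σ-+ᵗ-last (one t)     = σ-+ᵗ t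
  σ-+ᵗ-last (cons _ ts) = σ-+ᵗ-last ts

  σ-⊣ᵗ : ∀ x y → σ-Reverses _⊣ᵗ_ _⊢ᵗ_ x y
  σ-⊣ᵗ leaf        y    = ≋-refl
  σ-⊣ᵗ (node a ts) leaf = ≡⇒≋ (sym (leaf-⊢ᵗ (σᵗ (node a ts))))
  σ-⊣ᵗ (node a ts) y@(node p qs) = begin
    σ (node a ts ⊣ᵗ y)
      ≡⟨ cong σ (⊣ᵗ-node a ts y (λ ())) ⟩
    σ (map (λ z → node a (setLast ts z)) (last ts +ᵗ y))
      ≡⟨ σ-map σ-setLast (last ts +ᵗ y) ⟩
    map F (σ (last ts +ᵗ y))
      ≈⟨ map-≋ F (σ-+ᵗ-last ts y) ⟩
    map F (σᵗ y +ᵗ σᵗ (last ts))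
      ≡⟨ ⊢ᵗ-node (σᵗ y) _ R (σᵗ-node≢leaf p qs) ⟨
    σᵗ y ⊢ᵗ node (σᵗ (last ts)) R
      ≡⟨ cong (σᵗ y ⊢ᵗ_) (σᵗ-node a ts) ⟨
    σᵗ y ⊢ᵗ σᵗ (node a ts) ∎
    where
      R = revσInit ts (one (σᵗ a))
      F : Tree → Tree
      F w = node w R
      σ-setLast : ∀ z → σᵗ (node a (setLast ts z)) ≡ F (σᵗ z)
      σ-setLast z = trans (σᵗ-node a (setLast ts z))
                          (cong₂ node (cong σᵗ (last-setLast ts z)) (revσInit-setLast ts z (one (σᵗ a))))

  σ-⊥ᵗ : ∀ x y → σ-Reverses _⊥ᵗ_ _⊥ᵗ_ x y
  σ-⊥ᵗ leaf        y    = ≡⇒≋ (sym (⊥ᵗ-leaf (σᵗ y)))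
  σ-⊥ᵗ (node a ts) leaf = ≋-refl
  σ-⊥ᵗ (node a ts) (node p qs) = begin
    σ (node a ts ⊥ᵗ node p qs)
      ≡⟨ cong σ (⊥ᵗ-node a ts p qs) ⟩
    σ (map (λ z → node a (spliceLast ts z qs)) (last ts +ᵗ p))
      ≡⟨ σ-map σ-spliceLast (last ts +ᵗ p) ⟩
    map F (σ (last ts +ᵗ p))
      ≈⟨ map-≋ F (σ-+ᵗ-last ts p) ⟩
    map F (σᵗ p +ᵗ σᵗ (last ts))
      ≡⟨ map-cong (λ w → cong (node Lq) (spliceLast-revσInit qs (one (σᵗ p)) w R)) _ ⟨
    map (λ w → node Lq (spliceLast P w R)) (σᵗ p +ᵗ σᵗ (last ts))
      ≡⟨ cong (λ u → map (λ w → node Lq (spliceLast P w R)) (u +ᵗ σᵗ (last ts))) (last-revσInit qs (one (σᵗ p))) ⟨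
    map (λ w → node Lq (spliceLast P w R)) (last P +ᵗ σᵗ (last ts))
      ≡⟨ ⊥ᵗ-node Lq P (σᵗ (last ts)) R ⟨
    node Lq P ⊥ᵗ node (σᵗ (last ts)) R
      ≡⟨ cong₂ _⊥ᵗ_ (σᵗ-node p qs) (σᵗ-node a ts) ⟨
    σᵗ (node p qs) ⊥ᵗ σᵗ (node a ts) ∎
    where
      R = revσInit ts (one (σᵗ a))
      P = revσInit qs (one (σᵗ p))
      Lq = σᵗ (last qs)
      F : Tree → Tree
      F w = node Lq (revσInit qs (cons w R))
      σ-spliceLast : ∀ z → σᵗ (node a (spliceLast ts z qs)) ≡ F (σᵗ z)
      σ-spliceLast z = trans (σᵗ-node a (spliceLast ts z qs))
                             (cong₂ node (cong σᵗ (last-spliceLast ts z qs)) (revσInit-spliceLast ts z qs (one (σᵗ a))))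

  σ-⊢ᵗ : ∀ x y → σ-Reverses _⊢ᵗ_ _⊣ᵗ_ x y
  σ-⊢ᵗ x             leaf        = ≋-refl
  σ-⊢ᵗ leaf          (node p qs) = ≡⇒≋ (sym (⊣ᵗ-leaf (σᵗ (node p qs))))
  σ-⊢ᵗ x@(node a ts) (node p qs) = begin
    σ (map (λ z → node z qs) (x +ᵗ p))
      ≡⟨ σ-map (λ z → σᵗ-node z qs) (x +ᵗ p) ⟩
    map F (σ (x +ᵗ p))
      ≈⟨ map-≋ F (σ-+ᵗ x p) ⟩
    map F (σᵗ p +ᵗ σᵗ x)
      ≡⟨ map-cong (λ w → cong (node Lq) (setLast-revσInit qs (one (σᵗ p)) w)) _ ⟨
    map (λ w → node Lq (setLast P w)) (σᵗ p +ᵗ σᵗ x)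
      ≡⟨ cong (λ u → map (λ w → node Lq (setLast P w)) (u +ᵗ σᵗ x)) (last-revσInit qs (one (σᵗ p))) ⟨
    map (λ w → node Lq (setLast P w)) (last P +ᵗ σᵗ x)
      ≡⟨ ⊣ᵗ-node Lq P (σᵗ x) (σᵗ-node≢leaf a ts) ⟨
    node Lq P ⊣ᵗ σᵗ x
      ≡⟨ cong (_⊣ᵗ σᵗ x) (σᵗ-node p qs) ⟨
    σᵗ (node p qs) ⊣ᵗ σᵗ x ∎
    where
      P = revσInit qs (one (σᵗ p))
      Lq = σᵗ (last qs)
      F : Tree → Tree
      F w = node Lq (revσInit qs (one w))

σ-⊣ : ∀ X Y → σ (X ⊣ Y) ≋ (σ Y ⊢ σ X)
σ-⊣ = lift-σ _⊣ᵗ_ _⊢ᵗ_ σ-⊣ᵗ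

σ-⊥ : ∀ X Y → σ (X ⊥ Y) ≋ (σ Y ⊥ σ X)
σ-⊥ = lift-σ _⊥ᵗ_ _⊥ᵗ_ σ-⊥ᵗ

σ-⊢ : ∀ X Y → σ (X ⊢ Y) ≋ (σ Y ⊣ σ X)
σ-⊢ = lift-σ _⊢ᵗ_ _⊣ᵗ_ σ-⊢ᵗ

⊣-cong : ∀ {X X' Y Y'} → X ≋ X' → Y ≋ Y' → (X ⊣ Y) ≋ (X' ⊣ Y')
⊣-cong = lift-cong _⊣ᵗ_

⊥-cong : ∀ {X X' Y Y'} → X ≋ X' → Y ≋ Y' → (X ⊥ Y) ≋ (X' ⊥ Y')
⊥-cong = lift-cong _⊥ᵗ_

⊢-cong : ∀ {X X' Y Y'} → X ≋ X' → Y ≋ Y' → (X ⊢ Y) ≋ (X' ⊢ Y')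
⊢-cong = lift-cong _⊢ᵗ_

mutual
  +ᵗ-nonempty : ∀ x y → ∃ (_∈ x +ᵗ y)
  +ᵗ-nonempty leaf        y             = y , here refl
  +ᵗ-nonempty (node a ts) leaf          = node a ts , here refl
  +ᵗ-nonempty (node a ts) y@(node _ _) =
    let u , u∈ = lastPlus-nonempty ts y in node a u , ∈-++⁺ˡ (∈-map⁺ (node a) u∈)

  lastPlus-nonempty : ∀ ts y → ∃ (_∈ lastPlus ts y)
  lastPlus-nonempty (one t) y =
    let u , u∈ = +ᵗ-nonempty t y in one u , ∈-map⁺ one u∈
  lastPlus-nonempty (cons t ts) y =
    let u , u∈ = lastPlus-nonempty ts y in cons t u , ∈-map⁺ (cons t) u∈

⊥ᵗ-nonempty : ∀ x y → ∃ (_∈ x ⊥ᵗ y)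
⊥ᵗ-nonempty leaf        y           = leaf , here refl
⊥ᵗ-nonempty (node a ts) leaf        = leaf , here refl
⊥ᵗ-nonempty (node a ts) (node p qs) rewrite ⊥ᵗ-node a ts p qs =
  let u , u∈ = +ᵗ-nonempty (last ts) p in node a (spliceLast ts u qs) , ∈-map⁺ _ u∈

concatMap-const : ∀ u (L : Grove) → ∃ (_∈ L) → concatMap (λ _ → [ u ]) L ≋ [ u ]
concatMap-const u L (t , t∈) = ⊆⇒≋ to (λ { (here refl) → ∈-concatMap⁺ (λ _ → [ u ]) (lose t∈ (here refl)) })
  where
    to : ∀ {s} → s ∈ concatMap (λ _ → [ u ]) L → s ∈ [ u ]
    to s∈ with find (∈-concatMap⁻ (λ _ → [ u ]) {xs = L} s∈)
    ... | _ , _ , here refl = here refl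

⊢ᵗ-⊣ᵗ-assoc : ∀ a b c → concatMap (_⊣ᵗ c) (a ⊢ᵗ b) ≋ concatMap (a ⊢ᵗ_) (b ⊣ᵗ c)
⊢ᵗ-⊣ᵗ-assoc a           leaf        c = ≋-refl
⊢ᵗ-⊣ᵗ-assoc leaf        (node p qs) c = begin
  (node p qs ⊣ᵗ c) ++ []                ≡⟨ ++-identityʳ _ ⟩
  node p qs ⊣ᵗ c                        ≡⟨ concatMap-pure (node p qs ⊣ᵗ c) ⟨
  concatMap [_] (node p qs ⊣ᵗ c)        ≡⟨ concatMap-cong leaf-⊢ᵗ (node p qs ⊣ᵗ c) ⟨
  concatMap (leaf ⊢ᵗ_) (node p qs ⊣ᵗ c) ∎
⊢ᵗ-⊣ᵗ-assoc (node a ts) (node p qs) leaf = begin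
  concatMap (_⊣ᵗ leaf) (node a ts ⊢ᵗ node p qs) ≡⟨ concatMap-cong ⊣ᵗ-leaf (node a ts ⊢ᵗ node p qs) ⟩
  concatMap [_] (node a ts ⊢ᵗ node p qs)        ≡⟨ concatMap-pure (node a ts ⊢ᵗ node p qs) ⟩
  node a ts ⊢ᵗ node p qs                        ≡⟨ ++-identityʳ _ ⟨
  (node a ts ⊢ᵗ node p qs) ++ []                ∎
⊢ᵗ-⊣ᵗ-assoc x@(node _ _) (node p qs) c@(node _ _) = begin
  concatMap (_⊣ᵗ c) (map (λ z → node z qs) (x +ᵗ p))
    ≡⟨ concatMap-map (_⊣ᵗ c) (λ z → node z qs) (x +ᵗ p) ⟩
  concatMap (λ z → map (node z) (lastPlus qs c)) (x +ᵗ p)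
    ≈⟨ concatMap-map-comm node (x +ᵗ p) (lastPlus qs c) ⟩
  concatMap (λ rs → map (λ z → node z rs) (x +ᵗ p)) (lastPlus qs c)
    ≡⟨ concatMap-map (x ⊢ᵗ_) (node p) (lastPlus qs c) ⟨
  concatMap (x ⊢ᵗ_) (map (node p) (lastPlus qs c)) ∎

⊥ᵗ-assoc : ∀ a b c → concatMap (_⊥ᵗ c) (a ⊥ᵗ b) ≋ concatMap (a ⊥ᵗ_) (b ⊥ᵗ c)
⊥ᵗ-assoc leaf b c = ≋-sym (concatMap-const leaf (b ⊥ᵗ c) (⊥ᵗ-nonempty b c))
⊥ᵗ-assoc (node _ _) leaf c = ≋-refl
⊥ᵗ-assoc x@(node _ _) y@(node _ _) leaf = begin
  concatMap (_⊥ᵗ leaf) (x ⊥ᵗ y)         ≡⟨ concatMap-cong ⊥ᵗ-leaf (x ⊥ᵗ y) ⟩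
  concatMap (λ _ → [ leaf ]) (x ⊥ᵗ y)   ≈⟨ concatMap-const leaf (x ⊥ᵗ y) (⊥ᵗ-nonempty x y) ⟩
  [ leaf ]                              ∎
⊥ᵗ-assoc (node a as) (node b bs) c@(node c₀ cs) = begin
  concatMap (_⊥ᵗ c) (node a as ⊥ᵗ node b bs)
    ≡⟨ cong (concatMap (_⊥ᵗ c)) (⊥ᵗ-node a as b bs) ⟩
  concatMap (_⊥ᵗ c) (map (λ z → node a (spliceLast as z bs)) Z₁)
    ≡⟨ concatMap-map (_⊥ᵗ c) _ Z₁ ⟩
  concatMap (λ z → node a (spliceLast as z bs) ⊥ᵗ c) Z₁
    ≡⟨ concatMap-cong ⊥ᵗ-left Z₁ ⟩
  concatMap (λ z → map (G z) Z₂) Z₁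
    ≈⟨ concatMap-map-comm G Z₁ Z₂ ⟩
  concatMap (λ w → map (λ z → G z w) Z₁) Z₂
    ≡⟨ concatMap-cong (λ w → ⊥ᵗ-node a as b (spliceLast bs w cs)) Z₂ ⟨
  concatMap (λ w → node a as ⊥ᵗ node b (spliceLast bs w cs)) Z₂
    ≡⟨ concatMap-map (node a as ⊥ᵗ_) _ Z₂ ⟨
  concatMap (node a as ⊥ᵗ_) (map (λ w → node b (spliceLast bs w cs)) Z₂)
    ≡⟨ cong (concatMap (node a as ⊥ᵗ_)) (⊥ᵗ-node b bs c₀ cs) ⟨
  concatMap (node a as ⊥ᵗ_) (node b bs ⊥ᵗ c) ∎
  where
    Z₁ = last as +ᵗ b
    Z₂ = last bs +ᵗ c₀
    G : Tree → Tree → Tree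
    G z w = node a (spliceLast as z (spliceLast bs w cs))
    ⊥ᵗ-left : ∀ z → node a (spliceLast as z bs) ⊥ᵗ c ≡ map (G z) Z₂
    ⊥ᵗ-left z = trans (⊥ᵗ-node a (spliceLast as z bs) c₀ cs)
                (trans (cong (λ u → map (λ w → node a (spliceLast (spliceLast as z bs) w cs)) (u +ᵗ c₀)) (last-spliceLast as z bs))
                       (map-cong (λ w → cong (node a) (spliceLast-assoc as z bs w cs)) Z₂))

⊢-⊣-assoc : ∀ A B C → ((A ⊢ B) ⊣ C) ≋ (A ⊢ (B ⊣ C))
⊢-⊣-assoc = lift-assoc _⊣ᵗ_ _⊢ᵗ_ ⊢ᵗ-⊣ᵗ-assoc

⊥-assoc : ∀ A B C → ((A ⊥ B) ⊥ C) ≋ (A ⊥ (B ⊥ C))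
⊥-assoc = lift-assoc _⊥ᵗ_ _⊥ᵗ_ ⊥ᵗ-assoc

middleStep : Grove → Tree → Grove → Grove
middleStep y leaf          M = M ⊥ y
middleStep y c@(node _ _) M = (M ⊥ W c y) ⊥ y

WM-cons : ∀ c ts y M → WM (cons c ts) y M ≡ WM ts y (middleStep y c M)
WM-cons leaf       ts y M = refl
WM-cons (node _ _) ts y M = refl

-- For x = x⁽⁰⁾ ∨ ⋯ ∨ x⁽ᵏ⁾ with children list ts = x⁽¹⁾ … x⁽ᵏ⁾, middleSum y ts y is the Middle sum M.
middleSum : Grove → Trees → Grove → Grove
middleSum y (one _)     M = M
middleSum y (cons c ts) M = middleSum y ts (middleStep y c M)

mirrorMiddleSum : Grove → Trees → Grove → Grove
mirrorMiddleSum y (one _)     N = N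
mirrorMiddleSum y (cons c ts) N = middleStep y (σᵗ c) (mirrorMiddleSum y ts N)

WM-middleSum : ∀ ts y M → WM ts y M ≡ middleSum y ts M ⊣ W (last ts) y
WM-middleSum (one _)     y M = refl
WM-middleSum (cons c ts) y M = trans (WM-cons c ts y M) (WM-middleSum ts y (middleStep y c M))

WM-revσInit : ∀ ts acc y N → WM (revσInit ts acc) y N ≡ WM acc y (mirrorMiddleSum y ts N)
WM-revσInit (one _)     acc y N = refl
WM-revσInit (cons c ts) acc y N =
  trans (WM-revσInit ts (cons (σᵗ c) acc) y N) (WM-cons (σᵗ c) acc y (mirrorMiddleSum y ts N))

W-σᵗ-node : ∀ a ts y → W (σᵗ (node a ts)) y ≡ W (σᵗ (last ts)) y ⊢ (mirrorMiddleSum y ts y ⊣ W (σᵗ a) y)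
W-σᵗ-node a ts y = trans (cong (λ t → W t y) (σᵗ-node a ts))
                         (cong (W (σᵗ (last ts)) y ⊢_) (WM-revσInit ts (one (σᵗ a)) y y))

leftFactor : Grove → Tree → Grove
leftFactor y leaf          = y
leftFactor y c@(node _ _) = y ⊥ W c y

rightFactor : Grove → Tree → Grove
rightFactor y leaf          = y
rightFactor y c@(node _ _) = W c y ⊥ y

middleStep-self : ∀ y c → middleStep y c y ≡ leftFactor y c ⊥ y
middleStep-self y leaf       = refl
middleStep-self y (node _ _) = refl

middleStep-⊥ : ∀ y c N → middleStep y c N ≋ (N ⊥ rightFactor y c)
middleStep-⊥ y leaf         N = ≋-refl
middleStep-⊥ y c@(node _ _) N = ⊥-assoc N (W c y) y

rightFactor-σᵗ-node : ∀ y a ts → rightFactor y (σᵗ (node a ts)) ≡ W (σᵗ (node a ts)) y ⊥ y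
rightFactor-σᵗ-node y a ts rewrite σᵗ-node a ts = refl

σ-leftFactor : ∀ y c → σ (W c y) ≋ W (σᵗ c) (σ y) → σ (leftFactor y c) ≋ rightFactor (σ y) (σᵗ c)
σ-leftFactor y leaf         σ-Wc = ≋-refl
σ-leftFactor y c@(node a ts) σ-Wc = begin
  σ (y ⊥ W c y)              ≈⟨ σ-⊥ y (W c y) ⟩
  σ (W c y) ⊥ σ y            ≈⟨ ⊥-cong σ-Wc (≋-refl {σ y}) ⟩
  W (σᵗ c) (σ y) ⊥ σ y       ≡⟨ rightFactor-σᵗ-node (σ y) a ts ⟨
  rightFactor (σ y) (σᵗ c)   ∎

middleStep-cong : ∀ y c {N N'} → N ≋ N' → middleStep y c N ≋ middleStep y c N'
middleStep-cong y c {N} {N'} N≋N' = begin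
  middleStep y c N         ≈⟨ middleStep-⊥ y c N ⟩
  N ⊥ rightFactor y c      ≈⟨ ⊥-cong N≋N' (≋-refl {rightFactor y c}) ⟩
  N' ⊥ rightFactor y c     ≈⟨ middleStep-⊥ y c N' ⟨
  middleStep y c N'        ∎

middleSum-cong : ∀ y ts {N N'} → N ≋ N' → middleSum y ts N ≋ middleSum y ts N'
middleSum-cong y (one _)     N≋N' = N≋N'
middleSum-cong y (cons c ts) N≋N' = middleSum-cong y ts (middleStep-cong y c N≋N')

middleSum-⊥ˡ : ∀ y ts L N → middleSum y ts (L ⊥ N) ≋ (L ⊥ middleSum y ts N)
middleSum-⊥ˡ y (one _)     L N = ≋-refl
middleSum-⊥ˡ y (cons c ts) L N = begin
  middleSum y ts (middleStep y c (L ⊥ N))   ≈⟨ middleSum-cong y ts step-⊥ˡ ⟩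
  middleSum y ts (L ⊥ middleStep y c N)     ≈⟨ middleSum-⊥ˡ y ts L (middleStep y c N) ⟩
  L ⊥ middleSum y ts (middleStep y c N)     ∎
  where
    step-⊥ˡ : middleStep y c (L ⊥ N) ≋ (L ⊥ middleStep y c N)
    step-⊥ˡ = begin
      middleStep y c (L ⊥ N)        ≈⟨ middleStep-⊥ y c (L ⊥ N) ⟩
      (L ⊥ N) ⊥ rightFactor y c     ≈⟨ ⊥-assoc L N (rightFactor y c) ⟩
      L ⊥ (N ⊥ rightFactor y c)     ≈⟨ ⊥-cong (≋-refl {L}) (middleStep-⊥ y c N) ⟨
      L ⊥ middleStep y c N          ∎

module _ (y : Grove) where

  mutual
    σ-W : ∀ x → σ (W x y) ≋ W (σᵗ x) (σ y)
    σ-W leaf        = ≋-refl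
    σ-W (node a ts) = begin
      σ (W a y ⊢ WM ts y y)
        ≡⟨ cong (λ G → σ (W a y ⊢ G)) (WM-middleSum ts y y) ⟩
      σ (W a y ⊢ (middleSum y ts y ⊣ W (last ts) y))
        ≈⟨ σ-⊢ (W a y) (middleSum y ts y ⊣ W (last ts) y) ⟩
      σ (middleSum y ts y ⊣ W (last ts) y) ⊣ σ (W a y)
        ≈⟨ ⊣-cong (σ-⊣ (middleSum y ts y) (W (last ts) y)) (σ-W a) ⟩
      (σ (W (last ts) y) ⊢ σ (middleSum y ts y)) ⊣ W (σᵗ a) (σ y)
        ≈⟨ ⊣-cong (⊢-cong (σ-W-last ts) (σ-middleSum ts)) (≋-refl {W (σᵗ a) (σ y)}) ⟩
      (W (σᵗ (last ts)) (σ y) ⊢ mirrorMiddleSum (σ y) ts (σ y)) ⊣ W (σᵗ a) (σ y)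
        ≈⟨ ⊢-⊣-assoc (W (σᵗ (last ts)) (σ y)) (mirrorMiddleSum (σ y) ts (σ y)) (W (σᵗ a) (σ y)) ⟩
      W (σᵗ (last ts)) (σ y) ⊢ (mirrorMiddleSum (σ y) ts (σ y) ⊣ W (σᵗ a) (σ y))
        ≡⟨ W-σᵗ-node a ts (σ y) ⟨
      W (σᵗ (node a ts)) (σ y) ∎

    σ-W-last : ∀ ts → σ (W (last ts) y) ≋ W (σᵗ (last ts)) (σ y)
    σ-W-last (one t)     = σ-W t
    σ-W-last (cons _ ts) = σ-W-last ts

    σ-middleSum : ∀ ts → σ (middleSum y ts y) ≋ mirrorMiddleSum (σ y) ts (σ y)
    σ-middleSum (one _)     = ≋-refl
    σ-middleSum (cons c ts) = begin
      σ (middleSum y ts (middleStep y c y))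
        ≡⟨ cong (λ M → σ (middleSum y ts M)) (middleStep-self y c) ⟩
      σ (middleSum y ts (leftFactor y c ⊥ y))
        ≈⟨ map-≋ σᵗ (middleSum-⊥ˡ y ts (leftFactor y c) y) ⟩
      σ (leftFactor y c ⊥ middleSum y ts y)
        ≈⟨ σ-⊥ (leftFactor y c) (middleSum y ts y) ⟩
      σ (middleSum y ts y) ⊥ σ (leftFactor y c)
        ≈⟨ ⊥-cong (σ-middleSum ts) (σ-leftFactor y c (σ-W c)) ⟩
      mirrorMiddleSum (σ y) ts (σ y) ⊥ rightFactor (σ y) (σᵗ c)
        ≈⟨ middleStep-⊥ (σ y) (σᵗ c) (mirrorMiddleSum (σ y) ts (σ y)) ⟨
      middleStep (σ y) (σᵗ c) (mirrorMiddleSum (σ y) ts (σ y)) ∎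

-- The identity holds for arbitrary lists of trees.
proposition12p6 : (x y : Grove) → IsGrove x → IsGrove y → σ (x × y) ≋ (σ x × σ y)
proposition12p6 x y _ _ = begin
  σ (concatMap (λ t → W t y) x)         ≡⟨ map-concatMap σᵗ (λ t → W t y) x ⟩
  concatMap (λ t → σ (W t y)) x         ≈⟨ concatMap-≋ {x} ≋-refl (σ-W y) ⟩
  concatMap (λ t → W (σᵗ t) (σ y)) x    ≡⟨ concatMap-map (λ t → W t (σ y)) σᵗ x ⟨
  σ x × σ y                             ∎
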